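{- If $G\notin\mathcal{R}$, then $G$ is not complementary vanishing.
   Context: For a graph $G$ with vertex set $\{v_1,\dots,v_n\}$, $\mathcal{S}(G)$ is the set of real symmetric $n\times n$ matrices $A=[a_{i,j}]$ such that for $i\neq j$, $a_{i,j}\neq 0$ if and only if $v_iv_j\in E(G)$ (diagonal entries are unrestricted). $\overline{G}$ is the complement of $G$. $G$ is complementary vanishing if there exist $A\in\mathcal{S}(G)$, $B\in\mathcal{S}(\overline{G})$ with $AB=O$. $\mathcal{M}$ is the set of complementary vanishing graphs $G$ such that both $G$ and $\overline{G}$ are connected. $\mathcal{R}$ is the smallest set of graphs containing $\mathcal{M}$ that is closed under disjoint unions, joins (disjoint union plus all edges between the two parts), and complements. -}

module Defs where

open import Level using (0ℓ)
open import Data.Bool using (Bool; true; false; not)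
open import Data.Nat using (ℕ; zero; suc) renaming (_+_ to _+ℕ_)
open import Data.Fin using (Fin; splitAt)
import Data.Fin as Fin
open import Data.Fin.Properties using (_≟_)
open import Data.Sum using (_⊎_; inj₁; inj₂)
open import Data.Product using (Σ; _×_; _,_; ∃)
open import Data.Empty using (⊥-elim)
open import Relation.Nullary using (¬_; yes; no)
open import Relation.Binary.PropositionalEquality using (_≡_; _≢_; refl; sym; cong)
open import Relation.Binary.Structures using (IsTotalOrder)
open import Algebra.Structures using (IsCommutativeRing)
open import Function.Bundles using (_⇔_; _↔_; Inverse)

-- The real numbers, given axiomatically as a (Dedekind-)complete ordered
-- field.  Every such field is isomorphic to ℝ, so quantifying over all of
-- them is the same as talking about ℝ.

record CompleteOrderedField : Set₁ where
  infixl 6 _+_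
  infixl 7 _*_
  infix  4 _≈_ _≤_
  field
    Carrier : Set
    _≈_     : Carrier → Carrier → Set
    _+_     : Carrier → Carrier → Carrier
    _*_     : Carrier → Carrier → Carrier
    -_      : Carrier → Carrier
    0#      : Carrier
    1#      : Carrier
    isCommutativeRing : IsCommutativeRing _≈_ _+_ _*_ -_ 0# 1#
    0≉1     : ¬ (0# ≈ 1#)
    inverse : ∀ x → ¬ (x ≈ 0#) → Σ Carrier λ y → x * y ≈ 1#
    _≤_     : Carrier → Carrier → Set
    isTotalOrder : IsTotalOrder _≈_ _≤_
    +-mono-≤ : ∀ x y z → x ≤ y → x + z ≤ y + z
    *-nonneg : ∀ x y → 0# ≤ x → 0# ≤ y → 0# ≤ x * y
    sup : (P : Carrier → Set) → (Σ Carrier P) →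
          (Σ Carrier λ b → ∀ x → P x → x ≤ b) →
          Σ Carrier λ s → (∀ x → P x → x ≤ s) ×
                          (∀ b → (∀ x → P x → x ≤ b) → s ≤ b)

record Graph (n : ℕ) : Set where
  field
    adj    : Fin n → Fin n → Bool
    adj-sym    : ∀ i j → adj i j ≡ adj j i
    adj-irrefl : ∀ i → adj i i ≡ false
open Graph public

compl-adj : ∀ {n} → Graph n → Fin n → Fin n → Bool
compl-adj G i j with i ≟ j
... | yes _ = false
... | no  _ = not (adj G i j)

compl : ∀ {n} → Graph n → Graph n
compl G = record { adj = compl-adj G ; adj-sym = s ; adj-irrefl = r }
  where
  s : ∀ i j → compl-adj G i j ≡ compl-adj G j i
  s i j with i ≟ j | j ≟ i
  ... | yes _ | yes _ = refl
  ... | yes p | no q  = ⊥-elim (q (sym p))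
  ... | no p  | yes q = ⊥-elim (p (sym q))
  ... | no _  | no _  = cong not (adj-sym G i j)
  r : ∀ i → compl-adj G i i ≡ false
  r i with i ≟ i
  ... | yes _ = refl
  ... | no p  = ⊥-elim (p refl)

sumAdj : ∀ {m n} → Bool → Graph m → Graph n →
         Fin m ⊎ Fin n → Fin m ⊎ Fin n → Bool
sumAdj c G H (inj₁ i) (inj₁ j) = adj G i j
sumAdj c G H (inj₂ i) (inj₂ j) = adj H i j
sumAdj c G H (inj₁ _) (inj₂ _) = c
sumAdj c G H (inj₂ _) (inj₁ _) = c

sumAdj-sym : ∀ {m n} c (G : Graph m) (H : Graph n) x y →
             sumAdj c G H x y ≡ sumAdj c G H y x
sumAdj-sym c G H (inj₁ i) (inj₁ j) = adj-sym G i j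
sumAdj-sym c G H (inj₂ i) (inj₂ j) = adj-sym H i j
sumAdj-sym c G H (inj₁ _) (inj₂ _) = refl
sumAdj-sym c G H (inj₂ _) (inj₁ _) = refl

sumAdj-irrefl : ∀ {m n} c (G : Graph m) (H : Graph n) x →
                sumAdj c G H x x ≡ false
sumAdj-irrefl c G H (inj₁ i) = adj-irrefl G i
sumAdj-irrefl c G H (inj₂ i) = adj-irrefl H i

sumGraph : ∀ {m n} → Bool → Graph m → Graph n → Graph (m +ℕ n)
sumGraph {m} c G H = record
  { adj = λ i j → sumAdj c G H (splitAt m i) (splitAt m j)
  ; adj-sym = λ i j → sumAdj-sym c G H (splitAt m i) (splitAt m j)
  ; adj-irrefl = λ i → sumAdj-irrefl c G H (splitAt m i)
  }

_⊔G_ : ∀ {m n} → Graph m → Graph n → Graph (m +ℕ n)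
G ⊔G H = sumGraph false G H

_∨G_ : ∀ {m n} → Graph m → Graph n → Graph (m +ℕ n)
G ∨G H = sumGraph true G H

record _≅G_ {m n} (G : Graph m) (H : Graph n) : Set where
  field
    bij : Fin m ↔ Fin n
    preserves : ∀ i j → adj G i j ≡ adj H (Inverse.to bij i) (Inverse.to bij j)

data Reachable {n} (G : Graph n) (i : Fin n) : Fin n → Set where
  here : Reachable G i i
  step : ∀ {j k} → Reachable G i j → adj G j k ≡ true → Reachable G i k

Connected : ∀ {n} → Graph n → Set
Connected {n} G = ∀ (i j : Fin n) → Reachable G i j

module _ (ℝ : CompleteOrderedField) where
  open CompleteOrderedField ℝ

  Matrix : ℕ → Set
  Matrix n = Fin n → Fin n → Carrier

  Σ[_] : ∀ n → (Fin n → Carrier) → Carrier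
  Σ[ zero  ] f = 0#
  Σ[ suc n ] f = f Fin.zero + Σ[ n ] (λ i → f (Fin.suc i))

  InS : ∀ {n} → Graph n → Matrix n → Set
  InS {n} G A = (∀ i j → A i j ≈ A j i) ×
                (∀ (i j : Fin n) → i ≢ j → ((¬ (A i j ≈ 0#)) ⇔ (adj G i j ≡ true)))

  ProductZero : ∀ {n} → Matrix n → Matrix n → Set
  ProductZero {n} A B = ∀ i k → Σ[ n ] (λ j → A i j * B j k) ≈ 0#

  ComplementaryVanishing : ∀ {n} → Graph n → Set
  ComplementaryVanishing {n} G =
    Σ (Matrix n) λ A → Σ (Matrix n) λ B →
      InS G A × InS (compl G) B × ProductZero A B

  InM : ∀ {n} → Graph n → Set
  InM G = ComplementaryVanishing G × Connected G × Connected (compl G)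

  data InR : ∀ {n} → Graph n → Set₁ where
    fromM : ∀ {n} {G : Graph n} → InM G → InR G
    union : ∀ {m n} {G : Graph m} {H : Graph n} → InR G → InR H → InR (G ⊔G H)
    join  : ∀ {m n} {G : Graph m} {H : Graph n} → InR G → InR H → InR (G ∨G H)
    complement : ∀ {n} {G : Graph n} → InR G → InR (compl G)
    iso   : ∀ {m n} {G : Graph m} {H : Graph n} → InR G → G ≅G H → InR H

{-# OPTIONS --safe #-}
module Submission where

open import Defs
open import Data.Nat using (ℕ)
open import Relation.Nullary using (¬_)

-- Every complementary vanishing graph lies in 𝓡, by strong induction on the
-- number of vertices. If G and its complement are both connected, G ∈ 𝓜. If G
-- is disconnected, split its vertices into the component of one vertex and the
-- rest: a matrix A ∈ 𝓢(G) vanishes between the two parts, so the principal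
-- submatrices of A and B on each part still multiply to zero, and G is the
-- disjoint union of two smaller complementary vanishing graphs. If only the
-- complement is disconnected, pass to it: AB = O gives BA = (AB)ᵀ = O.
-- Connectivity and the vanishing of a matrix entry are not decidable, but the
-- goal is a negation, so the whole argument runs in the double-negation monad.

open import Level using (Level)
open import Algebra.Bundles using (CommutativeMonoid)
open import Algebra.Structures using (IsCommutativeRing)
import Algebra.Properties.CommutativeMonoid.Sum as MonoidSum
open import Data.Bool using (Bool; true; false; not)
open import Data.Bool.Properties using (not-involutive; not-¬; ¬-not)
open import Data.Fin as Fin using (Fin; zero; suc; splitAt)
open import Data.Fin.Permutation using (Permutation; ↔⇒≡)
open import Data.Fin.Properties using (_≟_; splitAt-join; join-splitAt; nonZeroIndex)
import Data.Nat as ℕ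
open import Data.Nat using (_<_; >-nonZero⁻¹)
open import Data.Nat.Induction using (<-rec)
open import Data.Nat.Properties using (m<m+n)
open import Data.Product using (∃₂; _,_; proj₁)
open import Data.Sum using (_⊎_; inj₁; inj₂)
import Data.Sum as Sum
open import Data.Sum.Properties using (inj₁-injective; swap-involutive)
open import Function using (_∘_; id)
open import Function.Bundles using (_⇔_; mk⇔; mk↔ₛ′; Equivalence)
open import Function.Definitions using (Injective)
open import Relation.Binary.Core using (_Preserves_⟶_)
open import Relation.Binary.PropositionalEquality
  using (_≡_; _≢_; _≗_; refl; sym; trans; cong; cong₂; subst)
open import Relation.Nullary using (Dec; yes; no; does)
open import Relation.Nullary.Decidable using (¬¬-excluded-middle; does-⇔; dec-true; dec-false)
open import Relation.Nullary.Negation using (contradiction; negated-stable; ¬¬-map)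

private
  variable
    a b : Level
    A : Set a
    B : Set b
    n : ℕ

-- The library's ¬¬-Monad is confined to one universe level, but InR lives in Set₁.
return : A → ¬ ¬ A
return = contradiction

_>>=_ : ¬ ¬ A → (A → ¬ ¬ B) → ¬ ¬ B
m >>= f = negated-stable (¬¬-map f m)

¬¬-pull-Fin : {P : Fin n → Set a} → (∀ i → ¬ ¬ P i) → ¬ ¬ (∀ i → P i)
¬¬-pull-Fin {n = ℕ.zero} h = return λ ()
¬¬-pull-Fin {n = ℕ.suc n} {P = P} h = do
  p₀ ← h zero
  ps ← ¬¬-pull-Fin {P = P ∘ suc} (h ∘ suc)
  return λ { zero → p₀ ; (suc i) → ps i }

record Partition {n} (c : Fin n → Bool) : Set where
  field
    size₁ size₂ : ℕ
    to          : Fin n → Fin size₁ ⊎ Fin size₂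
    from        : Fin size₁ ⊎ Fin size₂ → Fin n
    from∘to     : ∀ x → from (to x) ≡ x
    to∘from     : ∀ y → to (from y) ≡ y
    colour₁     : ∀ a → c (from (inj₁ a)) ≡ true
    colour₂     : ∀ b → c (from (inj₂ b)) ≡ false

  from-injective : Injective _≡_ _≡_ from
  from-injective {y} {y′} eq = trans (sym (to∘from y)) (trans (cong to eq) (to∘from y′))

  from₁-injective : Injective _≡_ _≡_ (from ∘ inj₁)
  from₁-injective = inj₁-injective ∘ from-injective

  from₁≢from₂ : ∀ a b → from (inj₁ a) ≢ from (inj₂ b)
  from₁≢from₂ a b eq = not-¬ (colour₁ a) (trans (cong c eq) (colour₂ b))

  permutation : Permutation (size₁ ℕ.+ size₂) n
  permutation = mk↔ₛ′ (from ∘ splitAt size₁) (Fin.join size₁ size₂ ∘ to)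
    (λ x → trans (cong from (splitAt-join size₁ size₂ (to x))) (from∘to x))
    (λ i → trans (cong (Fin.join size₁ size₂) (to∘from (splitAt size₁ i))) (join-splitAt size₁ size₂ i))

  index₁ : ∀ x → c x ≡ true → Fin size₁
  index₁ x cx with to x in eq
  ... | inj₁ a = a
  ... | inj₂ b = contradiction (trans (cong c (sym (from∘to x))) (trans (cong (c ∘ from) eq) (colour₂ b)))
                               (not-¬ cx)

  size₁<n : Fin size₂ → size₁ < n
  size₁<n b = subst (size₁ <_) (↔⇒≡ permutation)
                    (m<m+n size₁ (>-nonZero⁻¹ size₂ {{nonZeroIndex b}}))

module _ {c : Fin n → Bool} where

  swap : Partition c → Partition (not ∘ c)
  swap P = record
    { size₁ = size₂ ; size₂ = size₁
    ; to = Sum.swap ∘ to ; from = from ∘ Sum.swap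
    ; from∘to = λ x → trans (cong from (swap-involutive (to x))) (from∘to x)
    ; to∘from = λ y → trans (cong Sum.swap (to∘from (Sum.swap y))) (swap-involutive y)
    ; colour₁ = cong not ∘ colour₂ ; colour₂ = cong not ∘ colour₁ }
    where open Partition P

  recolour : {c′ : Fin n → Bool} → c ≗ c′ → Partition c → Partition c′
  recolour c≗c′ P = record
    { Partition P
    ; colour₁ = λ a → trans (sym (c≗c′ _)) (colour₁ a)
    ; colour₂ = λ b → trans (sym (c≗c′ _)) (colour₂ b) }
    where open Partition P

insert₁ : {c : Fin (ℕ.suc n) → Bool} → c zero ≡ true → Partition (c ∘ suc) → Partition c
insert₁ {c = c} c₀ P = record
  { size₁ = ℕ.suc size₁ ; size₂ = size₂
  ; to = to′ ; from = from′ ; from∘to = from∘to′ ; to∘from = to∘from′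
  ; colour₁ = λ { zero → c₀ ; (suc a) → colour₁ a } ; colour₂ = colour₂ }
  where
  open Partition P
  to′ : Fin (ℕ.suc _) → Fin (ℕ.suc size₁) ⊎ Fin size₂
  to′ zero    = inj₁ zero
  to′ (suc x) = Sum.map₁ suc (to x)
  from′ : Fin (ℕ.suc size₁) ⊎ Fin size₂ → Fin (ℕ.suc _)
  from′ (inj₁ zero)    = zero
  from′ (inj₁ (suc a)) = suc (from (inj₁ a))
  from′ (inj₂ b)       = suc (from (inj₂ b))
  from∘to′ : ∀ x → from′ (to′ x) ≡ x
  from∘to′ zero = refl
  from∘to′ (suc x) with to x | from∘to x
  ... | inj₁ a | eq = cong suc eq
  ... | inj₂ b | eq = cong suc eq
  to∘from′ : ∀ y → to′ (from′ y) ≡ y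
  to∘from′ (inj₁ zero)    = refl
  to∘from′ (inj₁ (suc a)) = cong (Sum.map₁ suc) (to∘from (inj₁ a))
  to∘from′ (inj₂ b)       = cong (Sum.map₁ suc) (to∘from (inj₂ b))

partition : (c : Fin n → Bool) → Partition c
partition {n = ℕ.zero} c = record
  { size₁ = 0 ; size₂ = 0 ; to = λ () ; from = λ { (inj₁ ()) ; (inj₂ ()) }
  ; from∘to = λ () ; to∘from = λ { (inj₁ ()) ; (inj₂ ()) }
  ; colour₁ = λ () ; colour₂ = λ () }
partition {n = ℕ.suc n} c with c zero in c₀
... | true  = insert₁ c₀ (partition (c ∘ suc))
-- A false colour at 0 goes to class 1 of the swapped partition.
... | false = recolour (not-involutive ∘ c)
                (swap (insert₁ (cong not c₀) (swap (partition (c ∘ suc)))))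

Edge : Graph n → Fin n → Fin n → Set
Edge G x y = adj G x y ≡ true

induced : ∀ {p} → Graph n → (Fin p → Fin n) → Graph p
induced G F = record
  { adj = λ a b → adj G (F a) (F b)
  ; adj-sym = λ a b → adj-sym G (F a) (F b)
  ; adj-irrefl = adj-irrefl G ∘ F }

module _ (G : Graph n) where

  compl-adj-≢ : ∀ {i j} → i ≢ j → adj (compl G) i j ≡ not (adj G i j)
  compl-adj-≢ {i} {j} i≢j with i ≟ j
  ... | yes i≡j = contradiction i≡j i≢j
  ... | no  _   = refl

  compl-involutive : ∀ i j → adj (compl (compl G)) i j ≡ adj G i j
  compl-involutive i j with i ≟ j
  ... | yes refl = sym (adj-irrefl G i)
  ... | no  i≢j  = trans (cong not (compl-adj-≢ i≢j)) (not-involutive (adj G i j))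

  compl-compl-≅ : compl (compl G) ≅G G
  compl-compl-≅ = record { bij = mk↔ₛ′ id id (λ _ → refl) (λ _ → refl) ; preserves = compl-involutive }

  compl-induced : ∀ {p} {F : Fin p → Fin n} → Injective _≡_ _≡_ F →
                  ∀ a b → adj (compl (induced G F)) a b ≡ adj (induced (compl G) F) a b
  compl-induced {F = F} F-injective a b with a ≟ b
  ... | yes refl = sym (adj-irrefl (compl G) (F a))
  ... | no  a≢b  = sym (compl-adj-≢ (a≢b ∘ F-injective))

module _ {G : Graph n} {c : Fin n → Bool} (c-respects : c Preserves Edge G ⟶ _≡_)
         (P : Partition c) where
  open Partition P

  no-edge₁₂ : ∀ a b → adj G (from (inj₁ a)) (from (inj₂ b)) ≡ false
  no-edge₁₂ a b = ¬-not λ e → not-¬ (colour₁ a) (trans (c-respects e) (colour₂ b))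

  ⊔-induced-≅ : (induced G (from ∘ inj₁) ⊔G induced G (from ∘ inj₂)) ≅G G
  ⊔-induced-≅ = record { bij = permutation ; preserves = λ i j → adj-from (splitAt size₁ i) (splitAt size₁ j) }
    where
    adj-from : ∀ u v → sumAdj false (induced G (from ∘ inj₁)) (induced G (from ∘ inj₂)) u v
                       ≡ adj G (from u) (from v)
    adj-from (inj₁ a) (inj₁ a′) = refl
    adj-from (inj₂ b) (inj₂ b′) = refl
    adj-from (inj₁ a) (inj₂ b)  = sym (no-edge₁₂ a b)
    adj-from (inj₂ b) (inj₁ a)  = sym (trans (adj-sym G _ _) (no-edge₁₂ a b))

Disconnected : Graph n → Set
Disconnected {n} G = ∃₂ λ (i j : Fin n) → ¬ Reachable G i j

¬Disconnected⇒¬¬Connected : ∀ {G : Graph n} → ¬ Disconnected G → ¬ ¬ Connected G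
¬Disconnected⇒¬¬Connected G-conn =
  ¬¬-pull-Fin λ i → ¬¬-pull-Fin λ j → λ i↛j → G-conn (i , j , i↛j)

reachable-respects : ∀ {G : Graph n} {i} (reach? : ∀ x → Dec (Reachable G i x)) →
                     (does ∘ reach?) Preserves Edge G ⟶ _≡_
reachable-respects {G = G} reach? {x} {y} x–y =
  does-⇔ (mk⇔ (λ r → step r x–y) (λ r → step r (trans (adj-sym G y x) x–y))) (reach? x) (reach? y)

module _ (ℝ : CompleteOrderedField) where
  open CompleteOrderedField ℝ using (Carrier; _≈_; _+_; _*_; 0#; isCommutativeRing)
  open IsCommutativeRing isCommutativeRing
    using (+-isCommutativeMonoid; +-assoc; +-congˡ; +-identityˡ; +-identityʳ; *-comm; *-cong; zeroˡ;
           setoid)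
    renaming (refl to ≈-refl; sym to ≈-sym; trans to ≈-trans)
  open import Relation.Binary.Reasoning.Setoid setoid

  +-commutativeMonoid : CommutativeMonoid _ _
  +-commutativeMonoid = record { isCommutativeMonoid = +-isCommutativeMonoid }

  open MonoidSum +-commutativeMonoid using (sum; sum-cong-≋; sum-permute; sum-replicate-zero)

  Σ≡sum : ∀ n (f : Fin n → Carrier) → Σ[_] ℝ n f ≡ sum f
  Σ≡sum ℕ.zero    f = refl
  Σ≡sum (ℕ.suc n) f = cong (f zero +_) (Σ≡sum n (f ∘ suc))

  Σ-cong : ∀ {f g : Fin n → Carrier} → (∀ i → f i ≈ g i) → Σ[_] ℝ n f ≈ Σ[_] ℝ n g
  Σ-cong {n} {f} {g} f≈g = begin
    Σ[_] ℝ n f ≡⟨ Σ≡sum n f ⟩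
    sum f      ≈⟨ sum-cong-≋ f≈g ⟩
    sum g      ≡⟨ Σ≡sum n g ⟨
    Σ[_] ℝ n g ∎

  Σ-zero : ∀ n → Σ[_] ℝ n (λ _ → 0#) ≈ 0#
  Σ-zero n = begin
    Σ[_] ℝ n (λ _ → 0#) ≡⟨ Σ≡sum n (λ _ → 0#) ⟩
    sum {n} (λ _ → 0#)  ≈⟨ sum-replicate-zero n ⟩
    0#                  ∎

  sum-splitAt : ∀ m {k} (g : Fin m ⊎ Fin k → Carrier) →
                sum (g ∘ splitAt m) ≈ sum (g ∘ inj₁) + sum (g ∘ inj₂)
  sum-splitAt ℕ.zero    g = ≈-sym (+-identityˡ _)
  sum-splitAt (ℕ.suc m) g = begin
    g (inj₁ zero) + sum (g ∘ Sum.map₁ suc ∘ splitAt m)          ≈⟨ +-congˡ (sum-splitAt m (g ∘ Sum.map₁ suc)) ⟩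
    g (inj₁ zero) + (sum (g ∘ inj₁ ∘ suc) + sum (g ∘ inj₂))     ≈⟨ +-assoc _ _ _ ⟨
    sum (g ∘ inj₁) + sum (g ∘ inj₂)                             ∎

  module _ {c : Fin n → Bool} (P : Partition c) where
    open Partition P

    Σ-partition : ∀ f → Σ[_] ℝ n f ≈ Σ[_] ℝ size₁ (f ∘ from ∘ inj₁) + Σ[_] ℝ size₂ (f ∘ from ∘ inj₂)
    Σ-partition f = begin
      Σ[_] ℝ n f                                            ≡⟨ Σ≡sum n f ⟩
      sum f                                                 ≈⟨ sum-permute f permutation ⟩
      sum (f ∘ from ∘ splitAt size₁)                        ≈⟨ sum-splitAt size₁ (f ∘ from) ⟩
      sum (f ∘ from ∘ inj₁) + sum (f ∘ from ∘ inj₂)         ≡⟨ cong₂ _+_ (Σ≡sum size₁ (f ∘ from ∘ inj₁)) (Σ≡sum size₂ (f ∘ from ∘ inj₂)) ⟨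
      Σ[_] ℝ size₁ (f ∘ from ∘ inj₁) + Σ[_] ℝ size₂ (f ∘ from ∘ inj₂) ∎

    Σ-vanishing-off₁ : ∀ {f} → (∀ b → f (from (inj₂ b)) ≈ 0#) → Σ[_] ℝ n f ≈ Σ[_] ℝ size₁ (f ∘ from ∘ inj₁)
    Σ-vanishing-off₁ {f} f₂≈0 = begin
      Σ[_] ℝ n f                                                  ≈⟨ Σ-partition f ⟩
      Σ[_] ℝ size₁ (f ∘ from ∘ inj₁) + Σ[_] ℝ size₂ (f ∘ from ∘ inj₂) ≈⟨ +-congˡ (Σ-cong f₂≈0) ⟩
      Σ[_] ℝ size₁ (f ∘ from ∘ inj₁) + Σ[_] ℝ size₂ (λ _ → 0#)      ≈⟨ +-congˡ (Σ-zero size₂) ⟩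
      Σ[_] ℝ size₁ (f ∘ from ∘ inj₁) + 0#                           ≈⟨ +-identityʳ _ ⟩
      Σ[_] ℝ size₁ (f ∘ from ∘ inj₁)                                ∎

  InS-cong : ∀ {G H : Graph n} {M : Matrix ℝ n} → (∀ i j → adj G i j ≡ adj H i j) →
             InS ℝ G M → InS ℝ H M
  InS-cong {M = M} G≡H (M-sym , M-pattern) =
    M-sym , λ i j i≢j → subst (λ e → (¬ M i j ≈ 0#) ⇔ (e ≡ true)) (G≡H i j) (M-pattern i j i≢j)

  InS-induced : ∀ {p} {G : Graph n} {M : Matrix ℝ n} {F : Fin p → Fin n} → Injective _≡_ _≡_ F →
                InS ℝ G M → InS ℝ (induced G F) (λ a b → M (F a) (F b))
  InS-induced {F = F} F-injective (M-sym , M-pattern) =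
    (λ a b → M-sym (F a) (F b)) , λ a b a≢b → M-pattern (F a) (F b) (a≢b ∘ F-injective)

  InS-compl-induced : ∀ {p} {G : Graph n} {M : Matrix ℝ n} {F : Fin p → Fin n} → Injective _≡_ _≡_ F →
                      InS ℝ (compl G) M → InS ℝ (compl (induced G F)) (λ a b → M (F a) (F b))
  InS-compl-induced {G = G} {F = F} F-injective M∈S =
    InS-cong {G = induced (compl G) F} {H = compl (induced G F)} (λ a b → sym (compl-induced G F-injective a b))
             (InS-induced {G = compl G} F-injective M∈S)

  non-edge⇒¬¬zero : ∀ {G : Graph n} {M : Matrix ℝ n} → InS ℝ G M →
                    ∀ {i j} → i ≢ j → adj G i j ≡ false → ¬ ¬ M i j ≈ 0#
  non-edge⇒¬¬zero (_ , M-pattern) {i} {j} i≢j non-edge M≉0 =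
    contradiction (trans (sym (Equivalence.to (M-pattern i j i≢j) M≉0)) non-edge) λ ()

  CV-compl : ∀ {G : Graph n} → ComplementaryVanishing ℝ G → ComplementaryVanishing ℝ (compl G)
  CV-compl {G = G} (A , B , A∈S , B∈S , AB≈0) =
    B , A , B∈S , InS-cong {G = G} {H = compl (compl G)} (λ i j → sym (compl-involutive G i j)) A∈S , BA≈0
    where
    BA≈0 : ProductZero ℝ B A
    BA≈0 i k = ≈-trans (Σ-cong λ j → ≈-trans (*-comm _ _) (*-cong (proj₁ A∈S j k) (proj₁ B∈S i j)))
                       (AB≈0 k i)

  module _ {G : Graph n} {c : Fin n → Bool} (c-respects : c Preserves Edge G ⟶ _≡_)
           (P : Partition c) where
    open Partition P

    CV-induced₁ : ComplementaryVanishing ℝ G → ¬ ¬ ComplementaryVanishing ℝ (induced G (from ∘ inj₁))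
    CV-induced₁ (A , B , A∈S , B∈S , AB≈0) = do
      A₁₂≈0 ← A₁₂≈0-¬¬
      return ( restrict A , restrict B
             , InS-induced {G = G} from₁-injective A∈S
             , InS-compl-induced {G = G} from₁-injective B∈S
             , λ a d → ≈-trans (≈-sym (Σ-vanishing-off₁ P λ b → ≈-trans (*-cong (A₁₂≈0 a b) ≈-refl) (zeroˡ _)))
                               (AB≈0 (from (inj₁ a)) (from (inj₁ d))) )
      where
      restrict : Matrix ℝ n → Matrix ℝ size₁
      restrict M a b = M (from (inj₁ a)) (from (inj₁ b))
      A₁₂≈0-¬¬ : ¬ ¬ (∀ a b → A (from (inj₁ a)) (from (inj₂ b)) ≈ 0#)
      A₁₂≈0-¬¬ = ¬¬-pull-Fin λ a → ¬¬-pull-Fin λ b →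
                   non-edge⇒¬¬zero {G = G} A∈S (from₁≢from₂ a b) (no-edge₁₂ {G = G} c-respects P a b)

  CVInR : ℕ → Set₁
  CVInR n = (G : Graph n) → ComplementaryVanishing ℝ G → ¬ ¬ InR ℝ G

  CV-disconnected : (∀ {m} → m < n → CVInR m) →
                    (G : Graph n) → Disconnected G → ComplementaryVanishing ℝ G → ¬ ¬ InR ℝ G
  CV-disconnected IH G (i , j , i↛j) cv = ¬¬-pull-Fin (λ x → ¬¬-excluded-middle) >>= split-off-component
    where
    split-off-component : (∀ x → Dec (Reachable G i x)) → ¬ ¬ InR ℝ G
    split-off-component reach? = do
        cv₁ ← CV-induced₁ respects P cv
        cv₂ ← CV-induced₁ (cong not ∘ respects) (swap P) cv
        r₁ ← IH (size₁<n P j₂) _ cv₁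
        r₂ ← IH (size₁<n (swap P) i₁) _ cv₂
        return (iso (union r₁ r₂) (⊔-induced-≅ respects P))
      where
      open Partition using (size₁; size₂; index₁; size₁<n)
      P : Partition (does ∘ reach?)
      P = partition (does ∘ reach?)
      respects : (does ∘ reach?) Preserves Edge G ⟶ _≡_
      respects = reachable-respects reach?
      i₁ : Fin (size₁ P)
      i₁ = index₁ P i (dec-true (reach? i) here)
      j₂ : Fin (size₂ P)
      j₂ = index₁ (swap P) j (cong not (dec-false (reach? j) i↛j))

  CV⇒¬¬InR : CVInR n
  CV⇒¬¬InR {n} = <-rec CVInR induction-step n
    where
    induction-step : ∀ n → (∀ {m} → m < n → CVInR m) → CVInR n
    induction-step n IH G cv = ¬¬-excluded-middle >>= λ where
      (yes G-disc) → CV-disconnected IH G G-disc cv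
      (no G-conn)  → ¬¬-excluded-middle >>= λ where
        (yes Gᶜ-disc) → do
          r ← CV-disconnected IH (compl G) Gᶜ-disc (CV-compl cv)
          return (iso (complement r) (compl-compl-≅ G))
        (no Gᶜ-conn) → do
          G-connected  ← ¬Disconnected⇒¬¬Connected G-conn
          Gᶜ-connected ← ¬Disconnected⇒¬¬Connected Gᶜ-conn
          return (fromM (cv , G-connected , Gᶜ-connected))

proposition3p6 : (ℝ : CompleteOrderedField) → ∀ {n} (G : Graph n) →
    ¬ InR ℝ G → ¬ ComplementaryVanishing ℝ G
proposition3p6 ℝ G G∉𝓡 cv = CV⇒¬¬InR ℝ G cv G∉𝓡
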